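{- If $\delta$ is the deficiency of a $d$-dimensional extremal $(0,1)$-matrix $A$ of order $n$, then $0<\delta\le 1$.
   Context: A $d$-dimensional matrix of order $n$ is an array $(a_\alpha)_{\alpha\in\{1,\dots,n\}^d}$; $\mathrm{supp}(A)=\{\alpha:a_\alpha\ne0\}$; the hyperplane $\Gamma_{i,j}$ is the set of indices with $\alpha_i=j$. A polyplex of weight $W$ is a nonnegative matrix $K$ of order $n$ whose entries sum to at most $1$ over each hyperplane and to $W$ in total; a polydiagonal is a polyplex of weight $n$. A $(0,1)$-matrix $A$ contains $K$ if $\mathrm{supp}(K)\subseteq\mathrm{supp}(A)$. A $(0,1)$-matrix $A$ is extremal if it contains no polydiagonal, but for every index $\alpha$ with $a_\alpha=0$ the matrix obtained by changing $a_\alpha$ to $1$ contains a polydiagonal. The deficiency of an extremal matrix of order $n$ is $n$ minus the maximum weight of a polyplex contained in it.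
   Formalization: Polyplexes have rational entries, so the polydiagonals in the definition of extremality and the maximum-weight polyplex defining the deficiency δ are rational as well. -}

module Defs where

open import Data.Nat using (ℕ; zero; suc)
open import Data.Fin using (Fin)
import Data.Fin as Fin
open import Data.Vec using (Vec; []; _∷_; lookup)
open import Data.Vec.Properties using (≡-dec)
open import Data.List using (List; []; _∷_; map; concatMap; filter; foldr; allFin)
open import Data.Bool using (Bool; true; false)
open import Data.Integer using (+_)
open import Data.Rational using (ℚ; 0ℚ; 1ℚ; _+_; _-_; _≤_; _<_; _/_)
open import Data.Product using (Σ; _×_; ∃)
open import Relation.Nullary using (¬_; yes; no)
open import Relation.Binary.PropositionalEquality using (_≡_; _≢_)

Idx : ℕ → ℕ → Set
Idx d n = Vec (Fin n) d

indices : (d n : ℕ) → List (Idx d n)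
indices zero    n = [] ∷ []
indices (suc d) n = concatMap (λ j → map (λ α → j ∷ α) (indices d n)) (allFin n)

Matrix : ℕ → ℕ → Set
Matrix d n = Idx d n → ℚ

Matrix01 : ℕ → ℕ → Set
Matrix01 d n = Idx d n → Bool

sumℚ : List ℚ → ℚ
sumℚ = foldr _+_ 0ℚ

total : ∀ {d n} → Matrix d n → ℚ
total {d} {n} K = sumℚ (map K (indices d n))

hyperplaneSum : ∀ {d n} → Matrix d n → Fin d → Fin n → ℚ
hyperplaneSum {d} {n} K i j =
  sumℚ (map K (filter (λ α → lookup α i Fin.≟ j) (indices d n)))

IsPolyplex : ∀ {d n} → Matrix d n → Set
IsPolyplex {d} {n} K =
  (∀ α → 0ℚ ≤ K α) × (∀ i j → hyperplaneSum K i j ≤ 1ℚ)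

IsPolyplexOfWeight : ∀ {d n} → Matrix d n → ℚ → Set
IsPolyplexOfWeight K W = IsPolyplex K × total K ≡ W

ℕtoℚ : ℕ → ℚ
ℕtoℚ m = (+ m) / 1

IsPolydiagonal : ∀ {d n} → Matrix d n → Set
IsPolydiagonal {d} {n} K = IsPolyplexOfWeight K (ℕtoℚ n)

Contains : ∀ {d n} → Matrix01 d n → Matrix d n → Set
Contains A K = ∀ α → K α ≢ 0ℚ → A α ≡ true

ContainsPolydiagonal : ∀ {d n} → Matrix01 d n → Set
ContainsPolydiagonal {d} {n} A = ∃ λ (K : Matrix d n) → IsPolydiagonal K × Contains A K

setOne : ∀ {d n} → Matrix01 d n → Idx d n → Matrix01 d n
setOne A α β with ≡-dec Fin._≟_ β α
... | yes _ = true
... | no  _ = A β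

IsExtremal : ∀ {d n} → Matrix01 d n → Set
IsExtremal A =
  ¬ ContainsPolydiagonal A ×
  (∀ α → A α ≡ false → ContainsPolydiagonal (setOne A α))

IsMaxPolyplexIn : ∀ {d n} → Matrix01 d n → Matrix d n → Set
IsMaxPolyplexIn A K =
  IsPolyplex K × Contains A K ×
  (∀ K′ → IsPolyplex K′ → Contains A K′ → total K′ ≤ total K)

IsDeficiency : ∀ {d n} → Matrix01 d n → ℚ → Set
IsDeficiency {d} {n} A δ =
  Σ (Matrix d n) λ K → IsMaxPolyplexIn A K × δ ≡ ℕtoℚ n - total K

-- Every polyplex has weight at most n (sum its entries over the hyperplanes Γ_{1,j}), and a
-- polyplex of weight n contained in A would be a polydiagonal; so the deficiency is positive.
-- An extremal A has a zero entry α, since otherwise it contains the diagonal polydiagonal.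
-- Switching α on yields a polydiagonal, and deleting its entry at α, which is at most 1,
-- leaves a polyplex contained in A of weight at least n - 1; so the deficiency is at most 1.
-- That a polyplex of maximum weight exists at all is a fact about linear programs: the
-- polyplexes contained in A, together with a lower bound w on their weight, are the solutions
-- of a finite system of linear inequalities, and Fourier-Motzkin elimination of every variable
-- but w shows that the feasible values of w, being bounded by n, have a largest one.

module Submission where

open import Defs
open import Data.Nat using (ℕ; zero; suc; s≤s; z≤n)
import Data.Nat as ℕ
import Data.Integer as ℤ
import Data.Integer.Properties as ℤ
import Data.Nat.Coprimality as Coprimality
open import Data.Rational
  using (ℚ; 0ℚ; 1ℚ; _≤_; _<_; _+_; _*_; -_; _-_; mkℚ; _/_; 1/_; positive; nonNegative)
open import Data.Rational.Properties
open import Data.Rational.Solver using (module +-*-Solver)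
open import Data.Bool using (true; false)
import Data.Bool as Bool
open import Data.Fin using (Fin)
import Data.Fin as Fin
open import Data.Vec using ([]; _∷_; lookup; replicate)
open import Data.Vec.Properties using (≡-dec; ∷-injective; ∷-injectiveʳ; lookup-replicate)
open import Data.Maybe using (Maybe; just; nothing)
import Data.Maybe.Properties as Maybe
open import Data.List using (List; []; _∷_; _++_; map; concatMap; filter; allFin; length)
open import Data.List.Properties using (length-tabulate)
import Data.List.Extrema as Extrema
open import Data.List.Membership.Propositional using (_∈_; _∉_)
open import Data.List.Membership.Propositional.Properties using (∈-map⁺; ∈-map⁻; ∈-concat⁺′; ∈-allFin; ∈-filter⁺)
open import Data.List.Relation.Unary.Any as Any using (here; there; any?)
open import Data.List.Relation.Unary.All as All using (All; []; _∷_)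
import Data.List.Relation.Unary.All.Properties as All
open import Data.List.Relation.Unary.Unique.Propositional using (Unique)
import Data.List.Relation.Unary.Unique.Propositional.Properties as Unique
open import Data.List.Relation.Unary.AllPairs using ([]; _∷_)
import Data.List.Relation.Unary.AllPairs as AllPairs
import Data.List.Relation.Unary.AllPairs.Properties as AllPairs
open import Data.List.Relation.Binary.Disjoint.Propositional using (Disjoint)
open import Data.Product using (_×_; ∃; _,_; proj₁; proj₂)
open import Data.Empty using (⊥-elim)
open import Function using (_∘_; case_of_; _⇔_; mk⇔; Equivalence)
import Function.Properties.Equivalence as ⇔
open import Relation.Nullary using (¬_; Dec; yes; no)
open import Relation.Unary using (Decidable)
open import Relation.Binary using (DecidableEquality; DecTotalOrder; tri<; tri≈; tri>)
open import Relation.Binary.PropositionalEquality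

open +-*-Solver using (solve; con; _:+_; _:*_; _:-_; :-_; _:=_)
open Extrema (DecTotalOrder.totalOrder ≤-decTotalOrder) using (min; max; min≤xs; v≤min⁺; max≤v⁺; xs≤max)

1*t+e≤b⇔t≤b-e : ∀ t e b → 1ℚ * t + e ≤ b ⇔ t ≤ b - e
1*t+e≤b⇔t≤b-e t e b = mk⇔
  (λ h → subst₂ _≤_ (solve 2 (λ t e → con 1ℚ :* t :+ e :- e := t) refl t e) refl (+-monoˡ-≤ (- e) h))
  (λ h → subst₂ _≤_ (solve 2 (λ t e → t :+ e := con 1ℚ :* t :+ e) refl t e)
                    (solve 2 (λ b e → b :- e :+ e := b) refl b e) (+-monoˡ-≤ e h))

-1*t+e≤b⇔e-b≤t : ∀ t e b → (- 1ℚ) * t + e ≤ b ⇔ e - b ≤ t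
-1*t+e≤b⇔e-b≤t t e b = mk⇔
  (λ h → subst₂ _≤_ (solve 3 (λ t e b → con (- 1ℚ) :* t :+ e :+ (t :- b) := e :- b) refl t e b)
                    (solve 2 (λ t b → b :+ (t :- b) := t) refl t b) (+-monoˡ-≤ (t - b) h))
  (λ h → subst₂ _≤_ (solve 3 (λ t e b → e :- b :+ (b :- t) := con (- 1ℚ) :* t :+ e) refl t e b)
                    (solve 2 (λ t b → t :+ (b :- t) := b) refl t b) (+-monoˡ-≤ (b - t) h))

0*t+e≤b⇔e≤b : ∀ t e b → 0ℚ * t + e ≤ b ⇔ e ≤ b
0*t+e≤b⇔e≤b t e b = mk⇔ (subst (_≤ b) eq) (subst (_≤ b) (sym eq))
  where eq = solve 2 (λ t e → con 0ℚ :* t :+ e := e) refl t e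

a+c≤b+d⇔c-d≤b-a : ∀ a b c d → a + c ≤ b + d ⇔ c - d ≤ b - a
a+c≤b+d⇔c-d≤b-a a b c d = mk⇔
  (λ h → subst₂ _≤_ (solve 4 (λ a b c d → a :+ c :- (a :+ d) := c :- d) refl a b c d)
                    (solve 4 (λ a b c d → b :+ d :- (a :+ d) := b :- a) refl a b c d) (+-monoˡ-≤ (- (a + d)) h))
  (λ h → subst₂ _≤_ (solve 4 (λ a b c d → c :- d :+ (a :+ d) := a :+ c) refl a b c d)
                    (solve 4 (λ a b c d → b :- a :+ (a :+ d) := b :+ d) refl a b c d) (+-monoˡ-≤ (a + d) h))

p-q≤0⇔p≤q : ∀ p q → p - q ≤ 0ℚ ⇔ p ≤ q
p-q≤0⇔p≤q p q = mk⇔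
  (λ h → subst₂ _≤_ (solve 2 (λ p q → p :- q :+ q := p) refl p q) (+-identityˡ q) (+-monoˡ-≤ q h))
  (λ h → subst (p - q ≤_) (+-inverseʳ q) (+-monoˡ-≤ (- q) h))

-p≤0⇔0≤p : ∀ p → - p ≤ 0ℚ ⇔ 0ℚ ≤ p
-p≤0⇔0≤p p = subst (λ l → l ≤ 0ℚ ⇔ 0ℚ ≤ p) (+-identityˡ (- p)) (p-q≤0⇔p≤q 0ℚ p)

≤∧≢⇒< : ∀ {p q} → p ≤ q → p ≢ q → p < q
≤∧≢⇒< {p} {q} p≤q p≢q with <-cmp p q
... | tri< p<q _ _ = p<q
... | tri≈ _ p≡q _ = ⊥-elim (p≢q p≡q)
... | tri> _ _ q<p = ⊥-elim (<-irrefl refl (<-≤-trans q<p p≤q))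

q<p⇒0<p-q : ∀ {p q} → q < p → 0ℚ < p - q
q<p⇒0<p-q {p} {q} q<p = subst (_< p - q) (+-inverseʳ q) (+-monoˡ-< (- q) q<p)

p-r≤q⇒p-q≤r : ∀ {p q r} → p - r ≤ q → p - q ≤ r
p-r≤q⇒p-q≤r {p} {q} {r} h = subst₂ _≤_ (solve 3 (λ p q r → p :- r :+ (r :- q) := p :- q) refl p q r)
                                        (solve 2 (λ q r → q :+ (r :- q) := r) refl q r) (+-monoˡ-≤ (r - q) h)

*-cancelˡ-≤⇔ : ∀ s {p q} → 0ℚ < s → s * p ≤ s * q ⇔ p ≤ q
*-cancelˡ-≤⇔ s 0<s = mk⇔ (*-cancelˡ-≤-pos s {{positive 0<s}}) (*-monoˡ-≤-nonNeg s {{nonNegative (<⇒≤ 0<s)}})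

between : ∀ (L U : List ℚ) → All (λ u → All (_≤ u) L) U → ∃ λ t → All (_≤ t) L × All (t ≤_) U
between L U L≤U = max (min 0ℚ U) L , xs≤max _ L ,
  All.zipWith (λ (min≤u , L≤u) → max≤v⁺ min≤u L≤u) (min≤xs 0ℚ U , L≤U)

𝟙 : {P : Set} → Dec P → ℚ
𝟙 (yes _) = 1ℚ
𝟙 (no _)  = 0ℚ

𝟙-yes : ∀ {P : Set} → P → (p : Dec P) → 𝟙 p ≡ 1ℚ
𝟙-yes _ (yes _) = refl
𝟙-yes x (no ¬x) = ⊥-elim (¬x x)

𝟙-no : ∀ {P : Set} → ¬ P → (p : Dec P) → 𝟙 p ≡ 0ℚ
𝟙-no ¬x (yes x) = ⊥-elim (¬x x)
𝟙-no _  (no _)  = refl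

𝟙-nonNeg : ∀ {P : Set} (p : Dec P) → 0ℚ ≤ 𝟙 p
𝟙-nonNeg (yes _) = <⇒≤ (positive⁻¹ 1ℚ)
𝟙-nonNeg (no _)  = ≤-refl

𝟙≤1 : ∀ {P : Set} (p : Dec P) → 𝟙 p ≤ 1ℚ
𝟙≤1 (yes _) = ≤-refl
𝟙≤1 (no _)  = <⇒≤ (positive⁻¹ 1ℚ)

𝟙-cong : ∀ {P Q : Set} → (P → Q) → (Q → P) → (p : Dec P) (q : Dec Q) → 𝟙 p ≡ 𝟙 q
𝟙-cong P⇒Q Q⇒P (yes x) q = sym (𝟙-yes (P⇒Q x) q)
𝟙-cong P⇒Q Q⇒P (no ¬x) q = sym (𝟙-no (¬x ∘ Q⇒P) q)

𝟙-mono : ∀ {P Q : Set} → (P → Q) → (p : Dec P) (q : Dec Q) → 𝟙 p ≤ 𝟙 q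
𝟙-mono P⇒Q (yes x) q = ≤-reflexive (sym (𝟙-yes (P⇒Q x) q))
𝟙-mono P⇒Q (no _)  q = 𝟙-nonNeg q

-- ℕtoℚ m is a normalised fraction; rewriting it to the literal mkℚ (+ m) 0 _ lets _+_ compute.
ℕtoℚ-suc : ∀ m → ℕtoℚ (suc m) ≡ 1ℚ + ℕtoℚ m
ℕtoℚ-suc m rewrite ↥p/↧p≡p (mkℚ (ℤ.+ m) 0 (Coprimality.sym (Coprimality.1-coprimeTo m))) =
  cong (_/ 1) (cong (ℤ._+_ (ℤ.+ 1)) (sym (ℤ.*-identityʳ (ℤ.+ m))))

∑ : {A : Set} → (A → ℚ) → List A → ℚ
∑ f xs = sumℚ (map f xs)

∑-syntax : {A : Set} → List A → (A → ℚ) → ℚ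
∑-syntax xs f = ∑ f xs

infix 5 ∑-syntax
syntax ∑-syntax xs (λ x → e) = ∑[ x ∈ xs ] e

module _ {A : Set} where

  ∑-++ : ∀ (f : A → ℚ) xs ys → ∑ f (xs ++ ys) ≡ ∑ f xs + ∑ f ys
  ∑-++ f []       ys = sym (+-identityˡ _)
  ∑-++ f (x ∷ xs) ys = trans (cong (f x +_) (∑-++ f xs ys)) (sym (+-assoc (f x) _ _))

  ∑-cong : ∀ {f g : A → ℚ} → (∀ x → f x ≡ g x) → ∀ xs → ∑ f xs ≡ ∑ g xs
  ∑-cong f≡g []       = refl
  ∑-cong f≡g (x ∷ xs) = cong₂ _+_ (f≡g x) (∑-cong f≡g xs)

  ∑-0 : ∀ (xs : List A) → ∑[ x ∈ xs ] 0ℚ ≡ 0ℚ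
  ∑-0 []       = refl
  ∑-0 (x ∷ xs) = trans (+-identityˡ _) (∑-0 xs)

  ∑-*ˡ : ∀ c (f : A → ℚ) xs → ∑[ x ∈ xs ] c * f x ≡ c * ∑ f xs
  ∑-*ˡ c f []       = sym (*-zeroʳ c)
  ∑-*ˡ c f (x ∷ xs) = trans (cong (c * f x +_) (∑-*ˡ c f xs)) (sym (*-distribˡ-+ c (f x) _))

  ∑-neg : ∀ (f : A → ℚ) xs → ∑[ x ∈ xs ] - f x ≡ - ∑ f xs
  ∑-neg f []       = refl
  ∑-neg f (x ∷ xs) = trans (cong (- f x +_) (∑-neg f xs)) (sym (neg-distrib-+ (f x) _))

  ∑-+ : ∀ (f g : A → ℚ) xs → ∑[ x ∈ xs ] (f x + g x) ≡ ∑ f xs + ∑ g xs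
  ∑-+ f g []       = refl
  ∑-+ f g (x ∷ xs) = trans (cong (f x + g x +_) (∑-+ f g xs))
    (solve 4 (λ a b c d → (a :+ b) :+ (c :+ d) := (a :+ c) :+ (b :+ d)) refl (f x) (g x) (∑ f xs) (∑ g xs))

  ∑-mono-≤ : ∀ {f g : A → ℚ} → (∀ x → f x ≤ g x) → ∀ xs → ∑ f xs ≤ ∑ g xs
  ∑-mono-≤ f≤g []       = ≤-refl
  ∑-mono-≤ f≤g (x ∷ xs) = +-mono-≤ (f≤g x) (∑-mono-≤ f≤g xs)

  ∑-nonNeg : ∀ {f : A → ℚ} → (∀ x → 0ℚ ≤ f x) → ∀ xs → 0ℚ ≤ ∑ f xs
  ∑-nonNeg {f} 0≤f xs = subst (_≤ ∑ f xs) (∑-0 xs) (∑-mono-≤ 0≤f xs)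

  ∑-filter : ∀ {P : A → Set} (P? : Decidable P) (f : A → ℚ) xs →
             ∑ f (filter P? xs) ≡ ∑[ x ∈ xs ] 𝟙 (P? x) * f x
  ∑-filter P? f [] = refl
  ∑-filter P? f (x ∷ xs) with P? x
  ... | yes _ = cong₂ _+_ (sym (*-identityˡ (f x))) (∑-filter P? f xs)
  ... | no _  = trans (∑-filter P? f xs) (sym (trans (cong (_+ _) (*-zeroˡ (f x))) (+-identityˡ _)))

  ∑-1 : ∀ (xs : List A) → ∑[ x ∈ xs ] 1ℚ ≡ ℕtoℚ (length xs)
  ∑-1 []       = refl
  ∑-1 (x ∷ xs) = trans (cong (1ℚ +_) (∑-1 xs)) (sym (ℕtoℚ-suc (length xs)))

  ∑-𝟙-absent : (_≟_ : DecidableEquality A) (f : A → ℚ) {a : A} {xs : List A} →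
                All (a ≢_) xs → ∑[ x ∈ xs ] 𝟙 (x ≟ a) * f x ≡ 0ℚ
  ∑-𝟙-absent _≟_ f []                   = refl
  ∑-𝟙-absent _≟_ f {a} {x ∷ _} (a≢x ∷ a∉xs) =
    trans (cong₂ _+_ (trans (cong (_* f x) (𝟙-no (a≢x ∘ sym) (x ≟ a))) (*-zeroˡ (f x)))
                     (∑-𝟙-absent _≟_ f a∉xs))
          (+-identityˡ 0ℚ)

  ∑-select : (_≟_ : DecidableEquality A) (f : A → ℚ) {a : A} {xs : List A} →
             Unique xs → a ∈ xs → ∑[ x ∈ xs ] 𝟙 (x ≟ a) * f x ≡ f a
  ∑-select _≟_ f {a} (a∉xs ∷ _) (here refl) =
    trans (cong₂ _+_ (trans (cong (_* f a) (𝟙-yes refl (a ≟ a))) (*-identityˡ (f a)))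
                     (∑-𝟙-absent _≟_ f a∉xs))
          (+-identityʳ (f a))
  ∑-select _≟_ f {a} {x ∷ _} (x∉xs ∷ unique) (there a∈xs) =
    trans (cong₂ _+_ (trans (cong (_* f x) (𝟙-no x≢a (x ≟ a))) (*-zeroˡ (f x)))
                     (∑-select _≟_ f unique a∈xs))
          (+-identityˡ (f a))
    where
    x≢a : x ≢ a
    x≢a refl = All.lookup x∉xs a∈xs refl

module _ {A B : Set} where

  ∑-map : ∀ (f : B → ℚ) (g : A → B) xs → ∑ f (map g xs) ≡ ∑ (f ∘ g) xs
  ∑-map f g []       = refl
  ∑-map f g (x ∷ xs) = cong (f (g x) +_) (∑-map f g xs)

  ∑-swap : ∀ (f : A → B → ℚ) xs ys →
           ∑[ x ∈ xs ] ∑[ y ∈ ys ] f x y ≡ ∑[ y ∈ ys ] ∑[ x ∈ xs ] f x y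
  ∑-swap f []       ys = sym (∑-0 ys)
  ∑-swap f (x ∷ xs) ys =
    trans (cong (∑ (f x) ys +_) (∑-swap f xs ys)) (sym (∑-+ (f x) (λ y → ∑[ x ∈ xs ] f x y) ys))

∑-allFin-select : ∀ {n} (f : Fin n → ℚ) k → ∑[ j ∈ allFin n ] 𝟙 (j Fin.≟ k) * f j ≡ f k
∑-allFin-select {n} f k = ∑-select Fin._≟_ f (Unique.allFin⁺ n) (∈-allFin k)

∑-allFin-1 : ∀ n → ∑[ j ∈ allFin n ] 1ℚ ≡ ℕtoℚ n
∑-allFin-1 n = trans (∑-1 (allFin n)) (cong ℕtoℚ (length-tabulate {n = n} (λ j → j)))

_≟ᵢ_ : ∀ {d n} → DecidableEquality (Idx d n)
_≟ᵢ_ = ≡-dec Fin._≟_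

∈-indices : ∀ {d n} (α : Idx d n) → α ∈ indices d n
∈-indices {zero}      []      = here refl
∈-indices {suc d} {n} (k ∷ α) =
  ∈-concat⁺′ (∈-map⁺ (k ∷_) (∈-indices α)) (∈-map⁺ (λ j → map (j ∷_) (indices d n)) (∈-allFin k))

indices-unique : ∀ d n → Unique (indices d n)
indices-unique zero    n = [] ∷ []
indices-unique (suc d) n =
  Unique.concat⁺ (All.map⁺ (All.universal (λ j → Unique.map⁺ ∷-injectiveʳ (indices-unique d n)) (allFin n)))
                 (AllPairs.map⁺ (AllPairs.map disjoint (Unique.allFin⁺ n)))
  where
  disjoint : ∀ {j k : Fin n} → j ≢ k → Disjoint (map (j ∷_) (indices d n)) (map (k ∷_) (indices d n))
  disjoint j≢k (jα∈ , kβ∈) with ∈-map⁻ _ jα∈ | ∈-map⁻ _ kβ∈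
  ... | _ , _ , refl | _ , _ , jα≡kβ = j≢k (proj₁ (∷-injective jα≡kβ))

∑-indices-select : ∀ {d n} (f : Idx d n → ℚ) α → ∑[ β ∈ indices d n ] 𝟙 (β ≟ᵢ α) * f β ≡ f α
∑-indices-select {d} {n} f α = ∑-select _≟ᵢ_ f (indices-unique d n) (∈-indices α)

module _ {d n : ℕ} where

  hyperplaneSum-≡-∑ : ∀ (K : Matrix d n) i j →
    hyperplaneSum K i j ≡ ∑[ β ∈ indices d n ] 𝟙 (lookup β i Fin.≟ j) * K β
  hyperplaneSum-≡-∑ K i j = ∑-filter (λ β → lookup β i Fin.≟ j) K (indices d n)

  total-≡-∑-hyperplaneSum : ∀ (K : Matrix d n) i → total K ≡ ∑[ j ∈ allFin n ] hyperplaneSum K i j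
  total-≡-∑-hyperplaneSum K i = begin
    total K
      ≡⟨ ∑-cong (λ β → sym (∑-allFin-select (λ _ → K β) (lookup β i))) I ⟩
    ∑[ β ∈ I ] ∑[ j ∈ allFin n ] 𝟙 (j Fin.≟ lookup β i) * K β
      ≡⟨ ∑-swap _ I (allFin n) ⟩
    ∑[ j ∈ allFin n ] ∑[ β ∈ I ] 𝟙 (j Fin.≟ lookup β i) * K β
      ≡⟨ ∑-cong (λ j → ∑-cong (𝟙-flip j) I) (allFin n) ⟩
    ∑[ j ∈ allFin n ] ∑[ β ∈ I ] 𝟙 (lookup β i Fin.≟ j) * K β
      ≡⟨ ∑-cong (λ j → hyperplaneSum-≡-∑ K i j) (allFin n) ⟨
    ∑[ j ∈ allFin n ] hyperplaneSum K i j
      ∎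
    where
    open ≡-Reasoning
    I = indices d n
    𝟙-flip : ∀ j β → 𝟙 (j Fin.≟ lookup β i) * K β ≡ 𝟙 (lookup β i Fin.≟ j) * K β
    𝟙-flip j β = cong (_* K β) (𝟙-cong sym sym (j Fin.≟ lookup β i) (lookup β i Fin.≟ j))

  zero-isPolyplex : IsPolyplex {d} {n} (λ _ → 0ℚ)
  zero-isPolyplex = (λ _ → ≤-refl) ,
    λ i j → subst (_≤ 1ℚ) (sym (∑-0 (filter (λ β → lookup β i Fin.≟ j) (indices d n)))) (<⇒≤ (positive⁻¹ 1ℚ))

  polyplex-total≤n : ∀ {K : Matrix d n} → Fin d → IsPolyplex K → total K ≤ ℕtoℚ n
  polyplex-total≤n {K} i (_ , hyperplane≤1) = begin
    total K                               ≡⟨ total-≡-∑-hyperplaneSum K i ⟩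
    ∑[ j ∈ allFin n ] hyperplaneSum K i j ≤⟨ ∑-mono-≤ (hyperplane≤1 i) (allFin n) ⟩
    ∑[ j ∈ allFin n ] 1ℚ                  ≡⟨ ∑-allFin-1 n ⟩
    ℕtoℚ n                                ∎
    where open ≤-Reasoning

  polyplex-entry≤1 : ∀ {K : Matrix d n} → Fin d → IsPolyplex K → ∀ α → K α ≤ 1ℚ
  polyplex-entry≤1 {K} i (0≤K , hyperplane≤1) α = begin
    K α                                                          ≡⟨ ∑-indices-select K α ⟨
    ∑[ β ∈ indices d n ] 𝟙 (β ≟ᵢ α) * K β                         ≤⟨ ∑-mono-≤ entry≤ (indices d n) ⟩
    ∑[ β ∈ indices d n ] 𝟙 (lookup β i Fin.≟ lookup α i) * K β    ≡⟨ hyperplaneSum-≡-∑ K i (lookup α i) ⟨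
    hyperplaneSum K i (lookup α i)                               ≤⟨ hyperplane≤1 i (lookup α i) ⟩
    1ℚ                                                           ∎
    where
    open ≤-Reasoning
    entry≤ : ∀ β → 𝟙 (β ≟ᵢ α) * K β ≤ 𝟙 (lookup β i Fin.≟ lookup α i) * K β
    entry≤ β = *-monoʳ-≤-nonNeg (K β) {{nonNegative (0≤K β)}}
                 (𝟙-mono (cong (λ γ → lookup γ i)) (β ≟ᵢ α) (lookup β i Fin.≟ lookup α i))

diagonal : ∀ d n → Matrix d n
diagonal d n β = ∑[ k ∈ allFin n ] 𝟙 (β ≟ᵢ replicate d k)

module _ {d n : ℕ} where

  ∑-*-diagonal : ∀ (f : Idx d n → ℚ) →
    ∑[ β ∈ indices d n ] f β * diagonal d n β ≡ ∑[ k ∈ allFin n ] f (replicate d k)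
  ∑-*-diagonal f = begin
    ∑[ β ∈ I ] f β * diagonal d n β
      ≡⟨ ∑-cong (λ β → ∑-*ˡ (f β) _ (allFin n)) I ⟨
    ∑[ β ∈ I ] ∑[ k ∈ allFin n ] f β * 𝟙 (β ≟ᵢ rep k)
      ≡⟨ ∑-swap _ I (allFin n) ⟩
    ∑[ k ∈ allFin n ] ∑[ β ∈ I ] f β * 𝟙 (β ≟ᵢ rep k)
      ≡⟨ ∑-cong (λ k → ∑-cong (λ β → *-comm (f β) _) I) (allFin n) ⟩
    ∑[ k ∈ allFin n ] ∑[ β ∈ I ] 𝟙 (β ≟ᵢ rep k) * f β
      ≡⟨ ∑-cong (λ k → ∑-indices-select f (rep k)) (allFin n) ⟩
    ∑[ k ∈ allFin n ] f (rep k)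
      ∎
    where
    open ≡-Reasoning
    I = indices d n
    rep = replicate d

  diagonal-isPolydiagonal : IsPolydiagonal (diagonal d n)
  diagonal-isPolydiagonal = (diagonal≥0 , λ i j → ≤-reflexive (hyperplane≡1 i j)) , total≡n
    where
    open ≡-Reasoning
    I = indices d n

    diagonal≥0 : ∀ β → 0ℚ ≤ diagonal d n β
    diagonal≥0 β = ∑-nonNeg (λ k → 𝟙-nonNeg (β ≟ᵢ replicate d k)) (allFin n)

    hyperplane≡1 : ∀ i j → hyperplaneSum (diagonal d n) i j ≡ 1ℚ
    hyperplane≡1 i j = begin
      hyperplaneSum (diagonal d n) i j
        ≡⟨ hyperplaneSum-≡-∑ (diagonal d n) i j ⟩
      ∑[ β ∈ I ] 𝟙 (lookup β i Fin.≟ j) * diagonal d n β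
        ≡⟨ ∑-*-diagonal (λ β → 𝟙 (lookup β i Fin.≟ j)) ⟩
      ∑[ k ∈ allFin n ] 𝟙 (lookup (replicate d k) i Fin.≟ j)
        ≡⟨ ∑-cong on-diagonal (allFin n) ⟩
      ∑[ k ∈ allFin n ] 𝟙 (k Fin.≟ j) * 1ℚ
        ≡⟨ ∑-allFin-select (λ _ → 1ℚ) j ⟩
      1ℚ
        ∎
      where
      on-diagonal : ∀ k → 𝟙 (lookup (replicate d k) i Fin.≟ j) ≡ 𝟙 (k Fin.≟ j) * 1ℚ
      on-diagonal k = trans (𝟙-cong (trans (sym (lookup-replicate i k))) (trans (lookup-replicate i k))
                                   (lookup (replicate d k) i Fin.≟ j) (k Fin.≟ j))
                            (sym (*-identityʳ (𝟙 (k Fin.≟ j))))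

    total≡n : total (diagonal d n) ≡ ℕtoℚ n
    total≡n = begin
      total (diagonal d n)            ≡⟨ ∑-cong (λ β → *-identityˡ (diagonal d n β)) I ⟨
      ∑[ β ∈ I ] 1ℚ * diagonal d n β  ≡⟨ ∑-*-diagonal (λ _ → 1ℚ) ⟩
      ∑[ k ∈ allFin n ] 1ℚ            ≡⟨ ∑-allFin-1 n ⟩
      ℕtoℚ n                          ∎

setOne-≢ : ∀ {d n} (A : Matrix01 d n) {α β} → β ≢ α → setOne A α β ≡ A β
setOne-≢ A {α} {β} β≢α with ≡-dec Fin._≟_ β α
... | yes β≡α = ⊥-elim (β≢α β≡α)
... | no _    = refl

withoutEntry : ∀ {d n} → Idx d n → Matrix d n → Matrix d n
withoutEntry α K β = (1ℚ - 𝟙 (β ≟ᵢ α)) * K β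

module _ {d n : ℕ} (α : Idx d n) (K : Matrix d n) where

  private
    I = indices d n

    factor-nonNeg : ∀ β → 0ℚ ≤ 1ℚ - 𝟙 (β ≟ᵢ α)
    factor-nonNeg β = subst (_≤ 1ℚ - 𝟙 (β ≟ᵢ α)) (+-inverseʳ (𝟙 (β ≟ᵢ α)))
                            (+-monoˡ-≤ (- 𝟙 (β ≟ᵢ α)) (𝟙≤1 (β ≟ᵢ α)))

    factor≤1 : ∀ β → 1ℚ - 𝟙 (β ≟ᵢ α) ≤ 1ℚ
    factor≤1 β = subst (1ℚ - 𝟙 (β ≟ᵢ α) ≤_) (+-identityʳ 1ℚ)
                       (+-monoʳ-≤ 1ℚ (neg-antimono-≤ (𝟙-nonNeg (β ≟ᵢ α))))

  withoutEntry-nonNeg : ∀ {β} → 0ℚ ≤ K β → 0ℚ ≤ withoutEntry α K β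
  withoutEntry-nonNeg {β} 0≤Kβ =
    subst (_≤ withoutEntry α K β) (*-zeroˡ (K β))
          (*-monoʳ-≤-nonNeg (K β) {{nonNegative 0≤Kβ}} (factor-nonNeg β))

  withoutEntry-≤ : ∀ {β} → 0ℚ ≤ K β → withoutEntry α K β ≤ K β
  withoutEntry-≤ {β} 0≤Kβ =
    subst (withoutEntry α K β ≤_) (*-identityˡ (K β))
          (*-monoʳ-≤-nonNeg (K β) {{nonNegative 0≤Kβ}} (factor≤1 β))

  withoutEntry-isPolyplex : IsPolyplex K → IsPolyplex (withoutEntry α K)
  withoutEntry-isPolyplex (0≤K , hyperplane≤1) =
    (λ β → withoutEntry-nonNeg (0≤K β)) ,
    (λ i j → ≤-trans (∑-mono-≤ (λ β → withoutEntry-≤ (0≤K β)) (filter (λ β → lookup β i Fin.≟ j) I))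
                      (hyperplane≤1 i j))

  total-withoutEntry : total (withoutEntry α K) ≡ total K - K α
  total-withoutEntry = begin
    ∑[ β ∈ I ] (1ℚ - 𝟙 (β ≟ᵢ α)) * K β
      ≡⟨ ∑-cong (λ β → distrib (𝟙 (β ≟ᵢ α)) (K β)) I ⟩
    ∑[ β ∈ I ] (K β + - (𝟙 (β ≟ᵢ α) * K β))
      ≡⟨ ∑-+ K _ I ⟩
    total K + (∑[ β ∈ I ] - (𝟙 (β ≟ᵢ α) * K β))
      ≡⟨ cong (total K +_) (∑-neg _ I) ⟩
    total K - (∑[ β ∈ I ] 𝟙 (β ≟ᵢ α) * K β)
      ≡⟨ cong (_-_ (total K)) (∑-indices-select K α) ⟩
    total K - K α
      ∎
    where
    open ≡-Reasoning
    distrib : ∀ e k → (1ℚ - e) * k ≡ k + - (e * k)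
    distrib = solve 2 (λ e k → (con 1ℚ :- e) :* k := k :+ :- (e :* k)) refl

  withoutEntry-contained : ∀ {A : Matrix01 d n} → Contains (setOne A α) K → Contains A (withoutEntry α K)
  withoutEntry-contained {A} contained β entry≢0 with β ≟ᵢ α
  ... | yes _   = ⊥-elim (entry≢0 (*-zeroˡ (K β)))
  ... | no β≢α = trans (sym (setOne-≢ A β≢α))
                       (contained β (λ Kβ≡0 → entry≢0 (trans (cong ((1ℚ - 0ℚ) *_) Kβ≡0) (*-zeroʳ (1ℚ - 0ℚ)))))

module _ {d n : ℕ} {A : Matrix01 d n} (extremal : IsExtremal A) where

  extremal-zeroEntry : ∃ λ α → A α ≡ false
  extremal-zeroEntry with any? (λ α → A α Bool.≟ false) (indices d n)
  ... | yes some-zero = Any.satisfied some-zero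
  ... | no no-zero    = ⊥-elim (proj₁ extremal (diagonal d n , diagonal-isPolydiagonal , all-ones))
    where
    all-ones : Contains A (diagonal d n)
    all-ones α _ with A α in Aα≡
    ... | true  = refl
    ... | false = ⊥-elim (no-zero (Any.map (λ { refl → Aα≡ }) (∈-indices α)))

  extremal-heavyPolyplex : Fin d → ∀ α → A α ≡ false →
    ∃ λ K → IsPolyplex K × Contains A K × ℕtoℚ n - 1ℚ ≤ total K
  extremal-heavyPolyplex i α Aα≡false with proj₂ extremal α Aα≡false
  ... | K , (K-polyplex , total≡n) , contained =
    withoutEntry α K , withoutEntry-isPolyplex α K K-polyplex , withoutEntry-contained α K contained ,
    (begin
      ℕtoℚ n - 1ℚ    ≤⟨ +-monoʳ-≤ (ℕtoℚ n) (neg-antimono-≤ (polyplex-entry≤1 i K-polyplex α)) ⟩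
      ℕtoℚ n - K α   ≡⟨ cong (_- K α) total≡n ⟨
      total K - K α  ≡⟨ total-withoutEntry α K ⟨
      total (withoutEntry α K) ∎)
    where open ≤-Reasoning

  maxPolyplex-total<n : ∀ {K} → Fin d → IsMaxPolyplexIn A K → total K < ℕtoℚ n
  maxPolyplex-total<n {K} i (K-polyplex , K-contained , _) =
    ≤∧≢⇒< (polyplex-total≤n i K-polyplex)
          (λ total≡n → proj₁ extremal (K , (K-polyplex , total≡n) , K-contained))

  n-1≤maxPolyplex-total : ∀ {K} → Fin d → IsMaxPolyplexIn A K → ℕtoℚ n - 1ℚ ≤ total K
  n-1≤maxPolyplex-total i (_ , _ , K-maximal) =
    let α , Aα≡false = extremal-zeroEntry
        K′ , K′-polyplex , K′-contained , n-1≤total = extremal-heavyPolyplex i α Aα≡false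
    in ≤-trans n-1≤total (K-maximal K′ K′-polyplex K′-contained)

module FourierMotzkin {V : Set} (_≟V_ : DecidableEquality V) where

  record Inequality : Set where
    field
      coeff : V → ℚ
      bound : ℚ
  open Inequality public

  -- Only the coefficients of the variables listed in vs are read: eliminating v drops it from the list.
  eval : List V → (V → ℚ) → (V → ℚ) → ℚ
  eval vs a x = ∑[ v ∈ vs ] a v * x v

  Satisfies : List V → (V → ℚ) → Inequality → Set
  Satisfies vs x c = eval vs (coeff c) x ≤ bound c

  SatisfiesAll : List V → (V → ℚ) → List Inequality → Set
  SatisfiesAll vs x = All (Satisfies vs x)

  scale : ℚ → Inequality → Inequality
  scale s c = record { coeff = λ v → s * coeff c v ; bound = s * bound c }

  _⊕_ : Inequality → Inequality → Inequality
  p ⊕ q = record { coeff = λ v → coeff p v + coeff q v ; bound = bound p + bound q }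

  eval-scale : ∀ vs s a x → eval vs (λ v → s * a v) x ≡ s * eval vs a x
  eval-scale vs s a x = trans (∑-cong (λ v → *-assoc s (a v) (x v)) vs) (∑-*ˡ s (λ v → a v * x v) vs)

  eval-+ : ∀ vs a b x → eval vs (λ v → a v + b v) x ≡ eval vs a x + eval vs b x
  eval-+ vs a b x = trans (∑-cong (λ v → *-distribʳ-+ (x v) (a v) (b v)) vs) (∑-+ (λ v → a v * x v) (λ v → b v * x v) vs)

  _[_≔_] : (V → ℚ) → V → ℚ → V → ℚ
  (x [ v ≔ t ]) w with w ≟V v
  ... | yes _ = t
  ... | no _  = x w

  [≔]-same : ∀ x v t → (x [ v ≔ t ]) v ≡ t
  [≔]-same x v t with v ≟V v
  ... | yes _  = refl
  ... | no v≢v = ⊥-elim (v≢v refl)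

  [≔]-other : ∀ x {v w} t → w ≢ v → (x [ v ≔ t ]) w ≡ x w
  [≔]-other x {v} {w} t w≢v with w ≟V v
  ... | yes w≡v = ⊥-elim (w≢v w≡v)
  ... | no _    = refl

  eval-[≔] : ∀ {v} vs a x t → v ∉ vs → eval vs a (x [ v ≔ t ]) ≡ eval vs a x
  eval-[≔] []       a x t _    = refl
  eval-[≔] (w ∷ vs) a x t v∉ =
    cong₂ _+_ (cong (a w *_) ([≔]-other x t (λ w≡v → v∉ (here (sym w≡v)))))
              (eval-[≔] vs a x t (v∉ ∘ there))

  data Normaliser (q : ℚ) : Set where
    pos  : ∀ s → 0ℚ < s → s * q ≡ 1ℚ → Normaliser q
    neg  : ∀ s → 0ℚ < s → s * q ≡ - 1ℚ → Normaliser q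
    null : q ≡ 0ℚ → Normaliser q

  normalise : ∀ q → Normaliser q
  normalise q with <-cmp 0ℚ q
  ... | tri< 0<q _ _ = pos (1/ q) (positive⁻¹ _) (*-inverseˡ q)
    where instance _ = positive 0<q; _ = pos⇒nonZero q; _ = 1/pos⇒pos q
  ... | tri≈ _ 0≡q _ = null (sym 0≡q)
  ... | tri> _ _ q<0 = neg (1/ (- q)) (positive⁻¹ _) (trans (solve 2 (λ s q → s :* q := :- (s :* (:- q))) refl (1/ (- q)) q)
                                                             (cong -_ (*-inverseˡ (- q))))
    where instance _ = positive (neg-antimono-< q<0); _ = pos⇒nonZero (- q); _ = 1/pos⇒pos (- q)

  module Eliminate (v : V) where

    uppers lowers others : List Inequality → List Inequality
    uppers [] = []
    uppers (c ∷ cs) with normalise (coeff c v)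
    ... | pos s _ _ = scale s c ∷ uppers cs
    ... | neg _ _ _ = uppers cs
    ... | null _    = uppers cs
    lowers [] = []
    lowers (c ∷ cs) with normalise (coeff c v)
    ... | pos _ _ _ = lowers cs
    ... | neg s _ _ = scale s c ∷ lowers cs
    ... | null _    = lowers cs
    others [] = []
    others (c ∷ cs) with normalise (coeff c v)
    ... | pos _ _ _ = others cs
    ... | neg _ _ _ = others cs
    ... | null _    = c ∷ others cs

    HoldsAt : List V → (V → ℚ) → ℚ → Inequality → Set
    HoldsAt rest x t c = coeff c v * t + eval rest (coeff c) x ≤ bound c

    upperBound lowerBound : List V → (V → ℚ) → Inequality → ℚ
    upperBound rest x c = bound c - eval rest (coeff c) x
    lowerBound rest x c = eval rest (coeff c) x - bound c

    Bounded : List V → (V → ℚ) → ℚ → List Inequality → Set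
    Bounded rest x t cs =
      SatisfiesAll rest x (others cs) ×
      All (λ c → t ≤ upperBound rest x c) (uppers cs) ×
      All (λ c → lowerBound rest x c ≤ t) (lowers cs)

    module _ (rest : List V) (x : V → ℚ) (t : ℚ) where

      holdsAt-scale : ∀ {s} c → 0ℚ < s → HoldsAt rest x t c ⇔ HoldsAt rest x t (scale s c)
      holdsAt-scale {s} c 0<s = subst (λ l → HoldsAt rest x t c ⇔ l ≤ s * bound c) lhs≡ (⇔.sym (*-cancelˡ-≤⇔ s 0<s))
        where
        lhs≡ : s * (coeff c v * t + eval rest (coeff c) x) ≡ s * coeff c v * t + eval rest (λ w → s * coeff c w) x
        lhs≡ = trans (solve 4 (λ s a t e → s :* (a :* t :+ e) := s :* a :* t :+ s :* e) refl s (coeff c v) t _)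
                     (cong (s * coeff c v * t +_) (sym (eval-scale rest s (coeff c) x)))

      holdsAt⇔≤upperBound : ∀ {s} c → 0ℚ < s → s * coeff c v ≡ 1ℚ →
                            HoldsAt rest x t c ⇔ t ≤ upperBound rest x (scale s c)
      holdsAt⇔≤upperBound {s} c 0<s s*cᵥ≡1 = ⇔.trans (holdsAt-scale c 0<s)
        (subst (λ q → q * t + e ≤ b ⇔ t ≤ b - e) (sym s*cᵥ≡1) (1*t+e≤b⇔t≤b-e t e b))
        where e = eval rest (coeff (scale s c)) x; b = bound (scale s c)

      holdsAt⇔lowerBound≤ : ∀ {s} c → 0ℚ < s → s * coeff c v ≡ - 1ℚ →
                            HoldsAt rest x t c ⇔ lowerBound rest x (scale s c) ≤ t
      holdsAt⇔lowerBound≤ {s} c 0<s s*cᵥ≡-1 = ⇔.trans (holdsAt-scale c 0<s)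
        (subst (λ q → q * t + e ≤ b ⇔ e - b ≤ t) (sym s*cᵥ≡-1) (-1*t+e≤b⇔e-b≤t t e b))
        where e = eval rest (coeff (scale s c)) x; b = bound (scale s c)

      holdsAt⇔satisfies : ∀ c → coeff c v ≡ 0ℚ → HoldsAt rest x t c ⇔ Satisfies rest x c
      holdsAt⇔satisfies c cᵥ≡0 = subst (λ q → q * t + e ≤ bound c ⇔ e ≤ bound c) (sym cᵥ≡0) (0*t+e≤b⇔e≤b t e (bound c))
        where e = eval rest (coeff c) x

      holds⇒bounded : ∀ cs → All (HoldsAt rest x t) cs → Bounded rest x t cs
      holds⇒bounded [] [] = [] , [] , []
      holds⇒bounded (c ∷ cs) (h ∷ hs) with normalise (coeff c v) | holds⇒bounded cs hs
      ... | pos s 0<s e | os , us , ls = os , Equivalence.to (holdsAt⇔≤upperBound c 0<s e) h ∷ us , ls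
      ... | neg s 0<s e | os , us , ls = os , us , Equivalence.to (holdsAt⇔lowerBound≤ c 0<s e) h ∷ ls
      ... | null e      | os , us , ls = Equivalence.to (holdsAt⇔satisfies c e) h ∷ os , us , ls

      bounded⇒holds : ∀ cs → Bounded rest x t cs → All (HoldsAt rest x t) cs
      bounded⇒holds [] _ = []
      bounded⇒holds (c ∷ cs) b with normalise (coeff c v) | b
      ... | pos s 0<s e | os , u ∷ us , ls =
        Equivalence.from (holdsAt⇔≤upperBound c 0<s e) u ∷ bounded⇒holds cs (os , us , ls)
      ... | neg s 0<s e | os , us , l ∷ ls =
        Equivalence.from (holdsAt⇔lowerBound≤ c 0<s e) l ∷ bounded⇒holds cs (os , us , ls)
      ... | null e      | o ∷ os , us , ls =
        Equivalence.from (holdsAt⇔satisfies c e) o ∷ bounded⇒holds cs (os , us , ls)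

    holdsAt⇒satisfies-[≔] : ∀ {rest x t c} → v ∉ rest → HoldsAt rest x t c → Satisfies (v ∷ rest) (x [ v ≔ t ]) c
    holdsAt⇒satisfies-[≔] {rest} {x} {t} {c} v∉rest =
      subst₂ (λ y e → coeff c v * y + e ≤ bound c) (sym ([≔]-same x v t)) (sym (eval-[≔] rest (coeff c) x t v∉rest))

    eliminate : List Inequality → List Inequality
    eliminate cs = others cs ++ concatMap (λ p → map (p ⊕_) (lowers cs)) (uppers cs)

    satisfies-⊕⇔ : ∀ rest x p q → Satisfies rest x (p ⊕ q) ⇔ lowerBound rest x q ≤ upperBound rest x p
    satisfies-⊕⇔ rest x p q =
      subst (λ l → l ≤ bound p + bound q ⇔ lowerBound rest x q ≤ upperBound rest x p)
            (sym (eval-+ rest (coeff p) (coeff q) x))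
            (a+c≤b+d⇔c-d≤b-a (eval rest (coeff p) x) (bound p) (eval rest (coeff q) x) (bound q))

    satisfies-pairs⇔ : ∀ rest x (P Q : List Inequality) →
      SatisfiesAll rest x (concatMap (λ p → map (p ⊕_) Q) P) ⇔
      All (λ p → All (λ q → lowerBound rest x q ≤ upperBound rest x p) Q) P
    satisfies-pairs⇔ rest x P Q = mk⇔
      (λ h → All.map (λ {p} hp → All.map (λ {q} → Equivalence.to (satisfies-⊕⇔ rest x p q)) (All.map⁻ hp))
                     (All.map⁻ (All.concat⁻ h)))
      (λ h → All.concat⁺ (All.map⁺ (All.map (λ {p} hp → All.map⁺ (All.map (λ {q} → Equivalence.from (satisfies-⊕⇔ rest x p q)) hp)) h)))

    eliminate-sound : ∀ rest x cs → SatisfiesAll (v ∷ rest) x cs → SatisfiesAll rest x (eliminate cs)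
    eliminate-sound rest x cs h with holds⇒bounded rest x (x v) cs h
    ... | os , us , ls = All.++⁺ os (Equivalence.from (satisfies-pairs⇔ rest x (uppers cs) (lowers cs))
                                       (All.map (λ u → All.map (λ l → ≤-trans l u) ls) us))

    -- Any t between the lower and the upper bounds on v is a valid value for v.
    eliminate-complete : ∀ rest x cs → v ∉ rest → SatisfiesAll rest x (eliminate cs) →
                         ∃ λ t → SatisfiesAll (v ∷ rest) (x [ v ≔ t ]) cs
    eliminate-complete rest x cs v∉rest h =
      t , All.map (λ {c} → holdsAt⇒satisfies-[≔] {rest} {x} {t} {c} v∉rest)
                  (bounded⇒holds rest x t cs (All.++⁻ˡ (others cs) h , All.map⁻ t≤U , All.map⁻ L≤t))
      where
      L U : List ℚ
      L = map (lowerBound rest x) (lowers cs)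
      U = map (upperBound rest x) (uppers cs)

      L≤U : All (λ u → All (_≤ u) L) U
      L≤U = All.map⁺ (All.map (All.map⁺ {f = lowerBound rest x})
              (Equivalence.to (satisfies-pairs⇔ rest x (uppers cs) (lowers cs)) (All.++⁻ʳ (others cs) h)))

      t = proj₁ (between L U L≤U)
      L≤t = proj₁ (proj₂ (between L U L≤U))
      t≤U = proj₂ (proj₂ (between L U L≤U))

  open Eliminate using (eliminate; eliminate-sound; eliminate-complete)

  eliminateAll : List V → List Inequality → List Inequality
  eliminateAll []       cs = cs
  eliminateAll (w ∷ ws) cs = eliminateAll ws (eliminate w cs)

  eliminateAll-sound : ∀ ws us x cs → SatisfiesAll (ws ++ us) x cs → SatisfiesAll us x (eliminateAll ws cs)
  eliminateAll-sound []       us x cs h = h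
  eliminateAll-sound (w ∷ ws) us x cs h =
    eliminateAll-sound ws us x (eliminate w cs) (eliminate-sound w (ws ++ us) x cs h)

  eliminateAll-complete : ∀ ws us x cs → Unique (ws ++ us) → SatisfiesAll us x (eliminateAll ws cs) →
    ∃ λ y → SatisfiesAll (ws ++ us) y cs × (∀ u → u ∉ ws → y u ≡ x u)
  eliminateAll-complete []       us x cs _ h = x , h , λ _ _ → refl
  eliminateAll-complete (w ∷ ws) us x cs (w∉ ∷ unique) h =
    y [ w ≔ t ] , proj₂ step , λ u u∉ → trans ([≔]-other y t (u∉ ∘ here)) (y≡x u (u∉ ∘ there))
    where
    w∉ws++us : w ∉ ws ++ us
    w∉ws++us = All.All¬⇒¬Any w∉

    IH : ∃ λ y → SatisfiesAll (ws ++ us) y (eliminate w cs) × (∀ u → u ∉ ws → y u ≡ x u)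
    IH = eliminateAll-complete ws us x (eliminate w cs) unique h

    y : V → ℚ
    y = proj₁ IH

    y≡x : ∀ u → u ∉ ws → y u ≡ x u
    y≡x = proj₂ (proj₂ IH)

    step : ∃ λ t → SatisfiesAll (w ∷ ws ++ us) (y [ w ≔ t ]) cs
    step = eliminate-complete w (ws ++ us) y cs w∉ws++us (proj₁ (proj₂ IH))

    t : ℚ
    t = proj₁ step

  -- Eliminating every variable but v leaves a system in v alone, whose solutions form an interval;
  -- its right end is attained because the objective is bounded.
  maximum-attained : ∀ ws v cs {x₀} B → Unique ws → v ∉ ws →
    SatisfiesAll (ws ++ v ∷ []) x₀ cs → (∀ x → SatisfiesAll (ws ++ v ∷ []) x cs → x v ≤ B) →
    ∃ λ y → SatisfiesAll (ws ++ v ∷ []) y cs × (∀ x → SatisfiesAll (ws ++ v ∷ []) x cs → x v ≤ y v)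
  maximum-attained ws v cs {x₀} B unique-ws v∉ws x₀-sat ≤B =
    y , y-sat , λ x h → subst (x v ≤_) (sym yᵥ≡m) (≤m x h)
    where
    open Eliminate v using (uppers; upperBound; Bounded; holds⇒bounded; bounded⇒holds; holdsAt⇒satisfies-[≔])

    cs₁ : List Inequality
    cs₁ = eliminateAll ws cs

    bounds : ∀ x → SatisfiesAll (ws ++ v ∷ []) x cs → Bounded [] x (x v) cs₁
    bounds x h = holds⇒bounded [] x (x v) cs₁ (eliminateAll-sound ws (v ∷ []) x cs h)

    -- upperBound [] x c does not depend on x, as eval over [] is 0; the choice of x₀ is arbitrary.
    m : ℚ
    m = min B (map (upperBound [] x₀) (uppers cs₁))

    ≤m : ∀ x → SatisfiesAll (ws ++ v ∷ []) x cs → x v ≤ m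
    ≤m x h = v≤min⁺ (≤B x h) (All.map⁺ (proj₁ (proj₂ (bounds x h))))

    m-bounded : Bounded [] x₀ m cs₁
    m-bounded with bounds x₀ x₀-sat
    ... | os , _ , ls = os , All.map⁻ (min≤xs B _) , All.map (λ l → ≤-trans l (≤m x₀ x₀-sat)) ls

    unique : Unique (ws ++ v ∷ [])
    unique = Unique.++⁺ unique-ws ([] ∷ []) λ { (v∈ws , here refl) → v∉ws v∈ws }

    lifted : ∃ λ y → SatisfiesAll (ws ++ v ∷ []) y cs × (∀ u → u ∉ ws → y u ≡ (x₀ [ v ≔ m ]) u)
    lifted = eliminateAll-complete ws (v ∷ []) (x₀ [ v ≔ m ]) cs unique
               (All.map (λ {c} → holdsAt⇒satisfies-[≔] {[]} {x₀} {m} {c} λ ())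
                        (bounded⇒holds [] x₀ m cs₁ m-bounded))

    y : V → ℚ
    y = proj₁ lifted

    y-sat : SatisfiesAll (ws ++ v ∷ []) y cs
    y-sat = proj₁ (proj₂ lifted)

    yᵥ≡m : y v ≡ m
    yᵥ≡m = trans (proj₂ (proj₂ lifted) v v∉ws) ([≔]-same x₀ v m)

module PolyplexProgram {d n : ℕ} (A : Matrix01 d n) where

  open FourierMotzkin {Maybe (Idx d n)} (Maybe.≡-dec _≟ᵢ_)

  private
    I : List (Idx d n)
    I = indices d n

  entryVars vars : List (Maybe (Idx d n))
  entryVars = map just I
  vars      = entryVars ++ nothing ∷ []

  -- The variable just α stands for the entry K α, and nothing for a lower bound w on the weight of K.
  assignment : Matrix d n → ℚ → Maybe (Idx d n) → ℚ
  assignment K w (just α) = K α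
  assignment K w nothing  = w

  linearForm : (Idx d n → ℚ) → ℚ → Maybe (Idx d n) → ℚ
  linearForm f c (just α) = f α
  linearForm f c nothing  = c

  eval-linearForm : ∀ f c x → eval vars (linearForm f c) x ≡ (∑[ β ∈ I ] f β * x (just β)) + c * x nothing
  eval-linearForm f c x = trans (∑-++ (λ v → linearForm f c v * x v) entryVars (nothing ∷ []))
    (cong₂ _+_ (∑-map (λ v → linearForm f c v * x v) just I) (+-identityʳ (c * x nothing)))

  eval-linearForm-0 : ∀ f x → eval vars (linearForm f 0ℚ) x ≡ ∑[ β ∈ I ] f β * x (just β)
  eval-linearForm-0 f x = trans (eval-linearForm f 0ℚ x) (trans (cong (s +_) (*-zeroˡ (x nothing))) (+-identityʳ s))
    where s = ∑[ β ∈ I ] f β * x (just β)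

  weightBound : Inequality
  weightBound = record { coeff = linearForm (λ _ → - 1ℚ) 1ℚ ; bound = 0ℚ }

  entryNonNeg entryZero : Idx d n → Inequality
  entryNonNeg α = record { coeff = linearForm (λ β → - 𝟙 (β ≟ᵢ α)) 0ℚ ; bound = 0ℚ }
  entryZero   α = record { coeff = linearForm (λ β → 𝟙 (β ≟ᵢ α)) 0ℚ ; bound = 0ℚ }

  hyperplaneBound : Fin d → Fin n → Inequality
  hyperplaneBound i j = record { coeff = linearForm (λ β → 𝟙 (lookup β i Fin.≟ j)) 0ℚ ; bound = 1ℚ }

  zeros : List (Idx d n)
  zeros = filter (λ α → A α Bool.≟ false) I

  system : List Inequality
  system = weightBound ∷ map entryNonNeg I ++ map entryZero zeros ++
           concatMap (λ i → map (hyperplaneBound i) (allFin n)) (allFin d)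

  module _ (x : Maybe (Idx d n) → ℚ) where

    satisfies-weightBound⇔ : Satisfies vars x weightBound ⇔ x nothing ≤ total (x ∘ just)
    satisfies-weightBound⇔ = subst (λ l → l ≤ 0ℚ ⇔ x nothing ≤ total (x ∘ just)) (sym eval≡)
                                   (p-q≤0⇔p≤q (x nothing) (total (x ∘ just)))
      where
      eval≡ : eval vars (coeff weightBound) x ≡ x nothing - total (x ∘ just)
      eval≡ = trans (eval-linearForm (λ _ → - 1ℚ) 1ℚ x)
        (trans (cong (_+ 1ℚ * x nothing) (∑-*ˡ (- 1ℚ) (x ∘ just) I))
               (solve 2 (λ s w → con (- 1ℚ) :* s :+ con 1ℚ :* w := w :- s) refl (total (x ∘ just)) (x nothing)))

    satisfies-entryNonNeg⇔ : ∀ α → Satisfies vars x (entryNonNeg α) ⇔ 0ℚ ≤ x (just α)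
    satisfies-entryNonNeg⇔ α = subst (λ l → l ≤ 0ℚ ⇔ 0ℚ ≤ x (just α)) (sym eval≡) (-p≤0⇔0≤p (x (just α)))
      where
      eval≡ : eval vars (coeff (entryNonNeg α)) x ≡ - x (just α)
      eval≡ = begin
        eval vars (coeff (entryNonNeg α)) x
          ≡⟨ eval-linearForm-0 _ x ⟩
        ∑[ β ∈ I ] - 𝟙 (β ≟ᵢ α) * x (just β)
          ≡⟨ ∑-cong (λ β → neg-distribˡ-* (𝟙 (β ≟ᵢ α)) (x (just β))) I ⟨
        ∑[ β ∈ I ] - (𝟙 (β ≟ᵢ α) * x (just β))
          ≡⟨ ∑-neg (λ β → 𝟙 (β ≟ᵢ α) * x (just β)) I ⟩
        - (∑[ β ∈ I ] 𝟙 (β ≟ᵢ α) * x (just β))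
          ≡⟨ cong -_ (∑-indices-select (x ∘ just) α) ⟩
        - x (just α)
          ∎
        where open ≡-Reasoning

    satisfies-entryZero⇔ : ∀ α → Satisfies vars x (entryZero α) ⇔ x (just α) ≤ 0ℚ
    satisfies-entryZero⇔ α = subst (λ l → l ≤ 0ℚ ⇔ x (just α) ≤ 0ℚ) (sym eval≡) (⇔.refl)
      where
      eval≡ : eval vars (coeff (entryZero α)) x ≡ x (just α)
      eval≡ = trans (eval-linearForm-0 _ x) (∑-indices-select (x ∘ just) α)

    satisfies-hyperplaneBound⇔ : ∀ i j → Satisfies vars x (hyperplaneBound i j) ⇔ hyperplaneSum (x ∘ just) i j ≤ 1ℚ
    satisfies-hyperplaneBound⇔ i j = subst (λ l → l ≤ 1ℚ ⇔ hyperplaneSum (x ∘ just) i j ≤ 1ℚ) (sym eval≡) (⇔.refl)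
      where
      eval≡ : eval vars (coeff (hyperplaneBound i j)) x ≡ hyperplaneSum (x ∘ just) i j
      eval≡ = trans (eval-linearForm-0 _ x) (sym (hyperplaneSum-≡-∑ (x ∘ just) i j))

  polyplex⇒satisfies : ∀ {K w} → IsPolyplex K → Contains A K → w ≤ total K →
                       SatisfiesAll vars (assignment K w) system
  polyplex⇒satisfies {K} {w} (0≤K , hyperplane≤1) contained w≤total =
    weight ∷ All.++⁺ nonNegs (All.++⁺ zeroes hyperplanes)
    where
    open Equivalence using (from)
    x = assignment K w

    vanishes : ∀ {α} → A α ≡ false → K α ≡ 0ℚ
    vanishes {α} Aα≡false with K α ≟ 0ℚ
    ... | yes Kα≡0 = Kα≡0
    ... | no Kα≢0  = case trans (sym Aα≡false) (contained α Kα≢0) of λ ()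

    weight : Satisfies vars x weightBound
    weight = from (satisfies-weightBound⇔ x) w≤total

    nonNegs : SatisfiesAll vars x (map entryNonNeg I)
    nonNegs = All.map⁺ (All.universal (λ α → from (satisfies-entryNonNeg⇔ x α) (0≤K α)) I)

    zeroes : SatisfiesAll vars x (map entryZero zeros)
    zeroes = All.map⁺ (All.map (λ {α} Aα≡false → from (satisfies-entryZero⇔ x α) (≤-reflexive (vanishes Aα≡false)))
                               (All.all-filter (λ α → A α Bool.≟ false) I))

    hyperplanes : SatisfiesAll vars x (concatMap (λ i → map (hyperplaneBound i) (allFin n)) (allFin d))
    hyperplanes = All.concat⁺ (All.map⁺ (All.universal (λ i → All.map⁺ (All.universal (λ j →
                    from (satisfies-hyperplaneBound⇔ x i j) (hyperplane≤1 i j)) (allFin n))) (allFin d)))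

  satisfies⇒polyplex : ∀ {x} → SatisfiesAll vars x system →
    IsPolyplex (x ∘ just) × Contains A (x ∘ just) × x nothing ≤ total (x ∘ just)
  satisfies⇒polyplex {x} (weight ∷ others) =
    (nonNeg , hyperplane≤1) , contained , to (satisfies-weightBound⇔ x) weight
    where
    open Equivalence using (to)
    nonNegs    = All.++⁻ˡ (map entryNonNeg I) others
    zeroes     = All.++⁻ˡ (map entryZero zeros) (All.++⁻ʳ (map entryNonNeg I) others)
    hyperplanes = All.++⁻ʳ (map entryZero zeros) (All.++⁻ʳ (map entryNonNeg I) others)

    nonNeg : ∀ α → 0ℚ ≤ x (just α)
    nonNeg α = to (satisfies-entryNonNeg⇔ x α) (All.lookup (All.map⁻ nonNegs) (∈-indices α))

    hyperplane≤1 : ∀ i j → hyperplaneSum (x ∘ just) i j ≤ 1ℚ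
    hyperplane≤1 i j = to (satisfies-hyperplaneBound⇔ x i j)
      (All.lookup (All.map⁻ (All.lookup (All.map⁻ (All.concat⁻ hyperplanes)) (∈-allFin i))) (∈-allFin j))

    contained : Contains A (x ∘ just)
    contained α xα≢0 with A α in Aα≡
    ... | true  = refl
    ... | false = ⊥-elim (xα≢0 (≤-antisym (to (satisfies-entryZero⇔ x α) at-zero) (nonNeg α)))
      where at-zero = All.lookup (All.map⁻ zeroes) (∈-filter⁺ (λ α → A α Bool.≟ false) (∈-indices α) Aα≡)

  maximumPolyplex : Fin d → ∃ λ K → IsMaxPolyplexIn A K
  maximumPolyplex i =
    let y , y-sat , y-optimal = maximum-attained entryVars nothing system (ℕtoℚ n) unique nothing∉ zero-sat bounded
        y-polyplex , y-contained , w≤total = satisfies⇒polyplex y-sat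
    in y ∘ just , y-polyplex , y-contained ,
       λ K K-polyplex K-contained → ≤-trans (y-optimal _ (polyplex⇒satisfies K-polyplex K-contained ≤-refl)) w≤total
    where
    unique : Unique entryVars
    unique = Unique.map⁺ Maybe.just-injective (indices-unique d n)

    nothing∉ : nothing ∉ entryVars
    nothing∉ nothing∈ with ∈-map⁻ just nothing∈
    ... | _ , _ , ()

    zero-sat : SatisfiesAll vars (assignment (λ _ → 0ℚ) 0ℚ) system
    zero-sat = polyplex⇒satisfies zero-isPolyplex (λ _ 0≢0 → ⊥-elim (0≢0 refl)) (≤-reflexive (sym (∑-0 I)))

    bounded : ∀ x → SatisfiesAll vars x system → x nothing ≤ ℕtoℚ n
    bounded x x-sat =
      let polyplex , _ , w≤total = satisfies⇒polyplex x-sat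
      in ≤-trans w≤total (polyplex-total≤n i polyplex)

proposition3p6 : (d n : ℕ) → 1 ℕ.≤ d → (A : Matrix01 d n) → IsExtremal A →
    (∃ λ δ → IsDeficiency A δ) ×
    (∀ δ → IsDeficiency A δ → (0ℚ < δ) × (δ ≤ 1ℚ))
proposition3p6 (suc d) n (s≤s z≤n) A extremal =
  (ℕtoℚ n - total K , K , K-maximal , refl) , bounds
  where
  open PolyplexProgram A using (maximumPolyplex)

  K = proj₁ (maximumPolyplex Fin.zero)
  K-maximal = proj₂ (maximumPolyplex Fin.zero)

  bounds : ∀ δ → IsDeficiency A δ → (0ℚ < δ) × (δ ≤ 1ℚ)
  bounds _ (K′ , K′-maximal , refl) =
    q<p⇒0<p-q (maxPolyplex-total<n extremal Fin.zero K′-maximal) ,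
    p-r≤q⇒p-q≤r {ℕtoℚ n} {total K′} (n-1≤maxPolyplex-total extremal Fin.zero K′-maximal)
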